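{- Let $k$ and $r$ be positive integers with $r\le\lceil k/2\rceil$. Let $H$ be a bipartite graph with parts $A,B$, $|A|=|B|$ and $e(H)>(k-1)|H|/2$. Then there is a subgraph $H'$ of $H$ with parts $A'\subseteq A$, $B'\subseteq B$ such that (1) $e(H')>(k-1)|H'|/2$; (2) $\deg_{H'}(a)+\deg_{H'}(b)\ge k$ for all $a\in A'$, $b\in B'$; and moreover one of the following holds: (3-I) $\delta_{H'}(A')\ge k/2$, $\delta_{H'}(B')\ge r$, some $a\in A'$ has $\deg_{H'}(a)\ge k$, and $|A'|\le|B'|$; or (3-II) $\delta(H')\ge k/2$, some $b\in B'$ has $\deg_{H'}(b)\ge k$, and $\deg_H(a)>k-r$ for every $a\in A'$.
   Context: $|H|$ and $e(H)$ denote the number of vertices and edges of a graph $H$. For $X\subseteq V(H')$, $\delta_{H'}(X)=\min_{x\in X}\deg_{H'}(x)$; $\delta(H')$ is the minimum degree of $H'$. -}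

module Defs where

open import Data.Nat using (ℕ; zero; suc; _+_)
open import Data.Bool using (Bool; true; false; if_then_else_)
open import Data.Fin using (Fin; zero; suc)

countF : ∀ {n} → (Fin n → Bool) → ℕ
countF {zero}  f = 0
countF {suc n} f = (if f zero then 1 else 0) + countF (λ i → f (suc i))

sumF : ∀ {n} → (Fin n → ℕ) → ℕ
sumF {zero}  g = 0
sumF {suc n} g = g zero + sumF (λ i → g (suc i))

-- A bipartite graph with parts A = Fin n and B = Fin n (so |A| = |B| = n)
-- is given by its edge relation E a b (edge between a ∈ A and b ∈ B).
BipGraph : ℕ → Set
BipGraph n = Fin n → Fin n → Bool

degA : ∀ {n} → BipGraph n → Fin n → ℕ
degA E a = countF (λ b → E a b)

degB : ∀ {n} → BipGraph n → Fin n → ℕ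
degB E b = countF (λ a → E a b)

edges : ∀ {n} → BipGraph n → ℕ
edges E = sumF (λ a → degA E a)

{-# OPTIONS --safe #-}
-- Delete vertices from H one at a time. A deletion whose edge loss is at most half of the amount by
-- which it lowers (k-1)|H'| keeps e(H') > (k-1)|H'|/2; this allows deleting a ∈ A' with deg a < k/2,
-- b ∈ B' with deg b < r, and pairs a, b with deg a + deg b < k. When none is left, (2) holds, and if
-- |A'| ≤ |B'| then counting the edges from A' gives some deg a ≥ k, which is (3-I).
-- For |A'| > |B'| one also keeps the potential e(H') > (k-r)|A'| + (r-1)|B'| (true initially as
-- |A| = |B|). It survives the deletions above and that of any a ∈ A' with deg a ≤ k-r, and implies
-- (1) while |B'| ≤ |A'|. Once no such a is left, every a ∈ A' has deg_H a > k-r; from then on b ∈ B'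
-- with deg b < k/2 may be deleted as well, and when none is left counting the edges from B' gives some
-- deg b ≥ k, which is (3-II).
module Submission where

open import Defs
open import Data.Nat using (ℕ; zero; suc; _+_; _*_; _∸_; _≤_; _<_; z≤n; s≤s⁻¹; _≤?_; ⌈_/2⌉; ⌊_/2⌋)
open import Data.Nat.Properties
open import Data.Nat.Induction using (<-wellFounded)
open import Data.Nat.Tactic.RingSolver using (solve-∀)
open import Data.Bool using (Bool; true; false; _∧_; if_then_else_)
open import Data.Bool.Properties using (∧-conicalˡ; ∧-conicalʳ; ¬-not)
open import Data.Fin using (Fin; zero; suc)
open import Data.Fin.Properties using (any?)
open import Data.Fin.Subset using (Subset; _∈_; _∉_; _⊆_; _-_; ∣_∣; ⊤; inside; outside)
open import Data.Fin.Subset.Properties using (_∈?_; ∈⊤; drop-there; p─⊥≡p; p─q⊆p; x∈p∧x≢y⇒x∈p-y; x∈p⇒∣p-x∣<∣p∣; ∣⊤∣≡n)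
open import Data.Vec using (_∷_; []; lookup; here; there)
open import Data.Vec.Properties using ([]=⇒lookup; lookup⇒[]=)
open import Data.Product using (Σ; _×_; ∃-syntax; ∃₂; _,_; proj₁; proj₂)
open import Data.Sum using (_⊎_; inj₁; inj₂; [_,_]′)
import Data.Sum as Sum
open import Function using (_∘_; id)
open import Induction.WellFounded using (Acc; acc)
open import Relation.Nullary using (yes; no; contradiction)
open import Relation.Nullary.Decidable using (_×-dec_)
open import Relation.Binary.PropositionalEquality using (_≡_; _≢_; refl; sym; trans; cong; cong₂; subst)
open import Algebra.Properties.CommutativeMonoid.Sum +-0-commutativeMonoid using (sum; sum-cong-≗; ∑-comm)
open import Algebra.Properties.CommutativeSemigroup +-commutativeSemigroup using (x∙yz≈y∙xz; interchange)

open ≤-Reasoning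

-- Counting over Fin n

countF-mono : ∀ {n} {f g : Fin n → Bool} → (∀ i → f i ≡ true → g i ≡ true) → countF f ≤ countF g
countF-mono {zero}  _   = z≤n
countF-mono {suc n} f⇒g = +-mono-≤ (indicator-mono (f⇒g zero)) (countF-mono (f⇒g ∘ suc))
  where
  indicator-mono : ∀ {x y : Bool} → (x ≡ true → y ≡ true) → (if x then 1 else 0) ≤ (if y then 1 else 0)
  indicator-mono {false} _   = z≤n
  indicator-mono {true}  x⇒y rewrite x⇒y refl = ≤-refl

countF-false : ∀ {n} {f : Fin n → Bool} → (∀ i → f i ≡ false) → countF f ≡ 0
countF-false {zero}      _       = refl
countF-false {suc n} {f} f≡false rewrite f≡false zero = countF-false (f≡false ∘ suc)

sumF-mono : ∀ {n} {f g : Fin n → ℕ} → (∀ i → f i ≤ g i) → sumF f ≤ sumF g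
sumF-mono {zero}  _   = z≤n
sumF-mono {suc n} f≤g = +-mono-≤ (f≤g zero) (sumF-mono (f≤g ∘ suc))

sumF-≤-at : ∀ {n} {f g : Fin n → ℕ} i → (∀ j → j ≢ i → f j ≤ g j) → sumF f ≤ f i + sumF g
sumF-≤-at {f = f} {g} zero f≤g =
  +-monoʳ-≤ (f zero) (≤-trans (sumF-mono (λ j → f≤g (suc j) λ ())) (m≤n+m _ (g zero)))
sumF-≤-at {f = f} {g} (suc i) f≤g = begin
  f zero + sumF (f ∘ suc)                 ≤⟨ +-mono-≤ (f≤g zero λ ()) (sumF-≤-at i (λ j j≢i → f≤g (suc j) (λ { refl → j≢i refl }))) ⟩
  g zero + (f (suc i) + sumF (g ∘ suc))   ≡⟨ x∙yz≈y∙xz (g zero) (f (suc i)) (sumF (g ∘ suc)) ⟩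
  f (suc i) + (g zero + sumF (g ∘ suc))   ∎

sumF-≤-*∣∣ : ∀ {n} {f : Fin n → ℕ} {m} (P : Subset n) →
             (∀ i → i ∈ P → f i ≤ m) → (∀ i → i ∉ P → f i ≡ 0) → sumF f ≤ m * ∣ P ∣
sumF-≤-*∣∣ [] _ _ = z≤n
sumF-≤-*∣∣ {f = f} {m} (inside ∷ P) on off = begin
  f zero + sumF (f ∘ suc)  ≤⟨ +-mono-≤ (on zero here) (sumF-≤-*∣∣ P (λ i → on (suc i) ∘ there) (λ i i∉P → off (suc i) (i∉P ∘ drop-there))) ⟩
  m + m * ∣ P ∣            ≡⟨ *-suc m ∣ P ∣ ⟨
  m * suc ∣ P ∣            ∎
sumF-≤-*∣∣ {f = f} (outside ∷ P) on off rewrite off zero (λ ()) =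
  sumF-≤-*∣∣ P (λ i → on (suc i) ∘ there) (λ i i∉P → off (suc i) (i∉P ∘ drop-there))

sumF≡sum : ∀ {n} (f : Fin n → ℕ) → sumF f ≡ sum f
sumF≡sum {zero}  f = refl
sumF≡sum {suc n} f = cong (f zero +_) (sumF≡sum (f ∘ suc))

countF≡sum : ∀ {n} (f : Fin n → Bool) → countF f ≡ sum (λ i → if f i then 1 else 0)
countF≡sum {zero}  f = refl
countF≡sum {suc n} f = cong ((if f zero then 1 else 0) +_) (countF≡sum (f ∘ suc))

edges≡sumF-degB : ∀ {n} (M : BipGraph n) → edges M ≡ sumF (degB M)
edges≡sumF-degB M = begin-equality
  edges M                                            ≡⟨ sumF≡sum (degA M) ⟩
  sum (degA M)                                       ≡⟨ sum-cong-≗ (λ a → countF≡sum (M a)) ⟩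
  sum (λ a → sum (λ b → if M a b then 1 else 0))     ≡⟨ ∑-comm (λ a b → if M a b then 1 else 0) ⟩
  sum (λ b → sum (λ a → if M a b then 1 else 0))     ≡⟨ sum-cong-≗ (λ b → countF≡sum (λ a → M a b)) ⟨
  sum (degB M)                                       ≡⟨ sumF≡sum (degB M) ⟨
  sumF (degB M)                                      ∎

x∈p⇒∣p∣≡1+∣p-x∣ : ∀ {n} {x : Fin n} {p : Subset n} → x ∈ p → ∣ p ∣ ≡ suc ∣ p - x ∣
x∈p⇒∣p∣≡1+∣p-x∣ {p = inside ∷ p}  here      = cong (suc ∘ ∣_∣) (sym (p─⊥≡p p))
x∈p⇒∣p∣≡1+∣p-x∣ {p = inside ∷ p}  (there x∈p) = cong suc (x∈p⇒∣p∣≡1+∣p-x∣ x∈p)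
x∈p⇒∣p∣≡1+∣p-x∣ {p = outside ∷ p} (there x∈p) = x∈p⇒∣p∣≡1+∣p-x∣ x∈p

weight-remove : ∀ {n α} {x : Fin n} {p : Subset n} → x ∈ p → α * ∣ p ∣ ≡ α + α * ∣ p - x ∣
weight-remove {α = α} x∈p = trans (cong (α *_) (x∈p⇒∣p∣≡1+∣p-x∣ x∈p)) (*-suc α _)

2*m≡m+m : ∀ m → 2 * m ≡ m + m
2*m≡m+m m = cong (m +_) (+-identityʳ m)

2*-≤-+ : ∀ {x y z} → x ≤ y → x ≤ z → 2 * x ≤ y + z
2*-≤-+ {x} {y} {z} x≤y x≤z = subst (_≤ y + z) (sym (2*m≡m+m x)) (+-mono-≤ x≤y x≤z)

lighter-side : ∀ {K x y e} → K * x + K * y < 2 * e → e ≤ K * y → x < y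
lighter-side {K} {x} {y} {e} weights<2e e≤Ky = *-cancelˡ-< K x y (+-cancelʳ-< (K * y) (K * x) (K * y) (begin-strict
  K * x + K * y  <⟨ weights<2e ⟩
  2 * e          ≤⟨ *-monoʳ-≤ 2 e≤Ky ⟩
  2 * (K * y)    ≡⟨ 2*m≡m+m (K * y) ⟩
  K * y + K * y  ∎))

rearrangement : ∀ {s t p q} → s ≤ t → p ≤ q → t * p + s * q ≤ t * q + s * p
rearrangement {s} {t} {p} s≤t p≤q with m≤n⇒∃[o]m+o≡n p≤q
... | d , refl = begin
  t * p + s * (p + d)        ≡⟨ cong (t * p +_) (*-distribˡ-+ s p d) ⟩
  t * p + (s * p + s * d)    ≤⟨ +-monoʳ-≤ (t * p) (+-monoʳ-≤ (s * p) (*-monoˡ-≤ d s≤t)) ⟩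
  t * p + (s * p + t * d)    ≡⟨ cong (t * p +_) (+-comm (s * p) (t * d)) ⟩
  t * p + (t * d + s * p)    ≡⟨ +-assoc (t * p) (t * d) (s * p) ⟨
  t * p + t * d + s * p      ≡⟨ cong (_+ s * p) (*-distribˡ-+ t p d) ⟨
  t * (p + d) + s * p        ∎

skew≡ : ∀ t s p q → 2 * t * p + 2 * s * q ≡ (t * p + s * q) + (t * p + s * q)
skew≡ = solve-∀

even≡ : ∀ t s p q → (t + s) * p + (t + s) * q ≡ (t * p + s * q) + (t * q + s * p)
even≡ = solve-∀

skew-≤-even : ∀ {s t p q} → s ≤ t → p ≤ q → 2 * t * p + 2 * s * q ≤ (t + s) * p + (t + s) * q
skew-≤-even {s} {t} {p} {q} s≤t p≤q = begin
  2 * t * p + 2 * s * q              ≡⟨ skew≡ t s p q ⟩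
  (t * p + s * q) + (t * p + s * q)  ≤⟨ +-monoʳ-≤ (t * p + s * q) (rearrangement s≤t p≤q) ⟩
  (t * p + s * q) + (t * q + s * p)  ≡⟨ even≡ t s p q ⟨
  (t + s) * p + (t + s) * q          ∎

even-≤-skew : ∀ {s t p q} → s ≤ t → q ≤ p → (t + s) * p + (t + s) * q ≤ 2 * t * p + 2 * s * q
even-≤-skew {s} {t} {p} {q} s≤t q≤p = begin
  (t + s) * p + (t + s) * q          ≡⟨ even≡ t s p q ⟩
  (t * p + s * q) + (t * q + s * p)  ≤⟨ +-monoʳ-≤ (t * p + s * q) (rearrangement s≤t q≤p) ⟩
  (t * p + s * q) + (t * p + s * q)  ≡⟨ skew≡ t s p q ⟨
  2 * t * p + 2 * s * q              ∎

r≤⌈k/2⌉⇒split : ∀ {K s} → suc s ≤ ⌈ suc K /2⌉ → ∃[ t ] (s ≤ t × t + s ≡ K)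
r≤⌈k/2⌉⇒split {K} {s} r≤ = K ∸ s , m+n≤o⇒m≤o∸n s 2s≤K , m∸n+n≡m (m+n≤o⇒n≤o s 2s≤K)
  where
  s≤⌊K/2⌋ : s ≤ ⌊ K /2⌋
  s≤⌊K/2⌋ = s≤s⁻¹ r≤
  2s≤K : s + s ≤ K
  2s≤K = begin
    s + s                ≤⟨ +-mono-≤ s≤⌊K/2⌋ (≤-trans s≤⌊K/2⌋ (⌊n/2⌋≤⌈n/2⌉ K)) ⟩
    ⌊ K /2⌋ + ⌈ K /2⌉    ≡⟨ ⌊n/2⌋+⌈n/2⌉≡n K ⟩
    K                    ∎

-- Induced subgraphs

infix 9 _[_,_]

-- Opaque so that P and Q can be inferred from E [ P , Q ] (lookup is not injective).
opaque
  _[_,_] : ∀ {n} → BipGraph n → Subset n → Subset n → BipGraph n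
  (E [ P , Q ]) a b = (lookup P a ∧ lookup Q b) ∧ E a b

module _ {n} (E : BipGraph n) where

  opaque
    unfolding _[_,_]

    induced-sound : ∀ {P Q} a b → (E [ P , Q ]) a b ≡ true → E a b ≡ true × a ∈ P × b ∈ Q
    induced-sound {P} {Q} a b edge =
      ∧-conicalʳ _ _ edge , lookup⇒[]= a P (∧-conicalˡ _ _ ends) , lookup⇒[]= b Q (∧-conicalʳ _ _ ends)
      where
      ends : lookup P a ∧ lookup Q b ≡ true
      ends = ∧-conicalˡ _ _ edge

    induced-complete : ∀ {P Q a b} → E a b ≡ true → a ∈ P → b ∈ Q → (E [ P , Q ]) a b ≡ true
    induced-complete Eab a∈P b∈Q rewrite []=⇒lookup a∈P | []=⇒lookup b∈Q = Eab

  induced-mono : ∀ {P P′ Q Q′} a b → (a ∈ P → a ∈ P′) → (b ∈ Q → b ∈ Q′) →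
                 (E [ P , Q ]) a b ≡ true → (E [ P′ , Q′ ]) a b ≡ true
  induced-mono a b a⇒ b⇒ edge with induced-sound a b edge
  ... | Eab , a∈P , b∈Q = induced-complete Eab (a⇒ a∈P) (b⇒ b∈Q)

  degA-mono : ∀ {P P′ Q Q′ a} → (a ∈ P → a ∈ P′) → Q ⊆ Q′ → degA (E [ P , Q ]) a ≤ degA (E [ P′ , Q′ ]) a
  degA-mono {a = a} a⇒ Q⊆Q′ = countF-mono (λ b → induced-mono a b a⇒ Q⊆Q′)

  degB-mono : ∀ {P P′ Q Q′ b} → P ⊆ P′ → (b ∈ Q → b ∈ Q′) → degB (E [ P , Q ]) b ≤ degB (E [ P′ , Q′ ]) b
  degB-mono {b = b} P⊆P′ b⇒ = countF-mono (λ a → induced-mono a b P⊆P′ b⇒)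

  degA-induced≤degA : ∀ {P Q} a → degA (E [ P , Q ]) a ≤ degA E a
  degA-induced≤degA a = countF-mono (λ b → proj₁ ∘ induced-sound a b)

  degA-induced-∉ : ∀ {P Q a} → a ∉ P → degA (E [ P , Q ]) a ≡ 0
  degA-induced-∉ {a = a} a∉P = countF-false (λ b → ¬-not (a∉P ∘ proj₁ ∘ proj₂ ∘ induced-sound a b))

  degB-induced-∉ : ∀ {P Q b} → b ∉ Q → degB (E [ P , Q ]) b ≡ 0
  degB-induced-∉ {b = b} b∉Q = countF-false (λ a → ¬-not (b∉Q ∘ proj₂ ∘ proj₂ ∘ induced-sound a b))

  edges≤edges-induced-⊤ : edges E ≤ edges (E [ ⊤ , ⊤ ])
  edges≤edges-induced-⊤ = sumF-mono (λ a → countF-mono (λ b Eab → induced-complete {a = a} {b} Eab ∈⊤ ∈⊤))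

  edges-remove-A : ∀ {P Q} a → edges (E [ P , Q ]) ≤ degA (E [ P , Q ]) a + edges (E [ P - a , Q ])
  edges-remove-A a = sumF-≤-at a (λ j j≢a → degA-mono (λ j∈P → x∈p∧x≢y⇒x∈p-y j∈P j≢a) id)

  edges-remove-B : ∀ {P Q} b → edges (E [ P , Q ]) ≤ degB (E [ P , Q ]) b + edges (E [ P , Q - b ])
  edges-remove-B {P} {Q} b = begin
    edges (E [ P , Q ])                                  ≡⟨ edges≡sumF-degB (E [ P , Q ]) ⟩
    sumF (degB (E [ P , Q ]))                            ≤⟨ sumF-≤-at b (λ j j≢b → degB-mono id (λ j∈Q → x∈p∧x≢y⇒x∈p-y j∈Q j≢b)) ⟩
    degB (E [ P , Q ]) b + sumF (degB (E [ P , Q - b ])) ≡⟨ cong (degB (E [ P , Q ]) b +_) (edges≡sumF-degB (E [ P , Q - b ])) ⟨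
    degB (E [ P , Q ]) b + edges (E [ P , Q - b ])       ∎

  edges-remove-AB : ∀ {P Q} a b →
    edges (E [ P , Q ]) ≤ (degA (E [ P , Q ]) a + degB (E [ P , Q ]) b) + edges (E [ P - a , Q - b ])
  edges-remove-AB {P} {Q} a b = begin
    edges (E [ P , Q ])                                             ≤⟨ edges-remove-A a ⟩
    dA + edges (E [ P - a , Q ])                                    ≤⟨ +-monoʳ-≤ dA (edges-remove-B b) ⟩
    dA + (degB (E [ P - a , Q ]) b + edges (E [ P - a , Q - b ]))   ≤⟨ +-monoʳ-≤ dA (+-monoˡ-≤ _ (degB-mono (p─q⊆p P _) id)) ⟩
    dA + (degB (E [ P , Q ]) b + edges (E [ P - a , Q - b ]))       ≡⟨ +-assoc dA _ _ ⟨
    (dA + degB (E [ P , Q ]) b) + edges (E [ P - a , Q - b ])       ∎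
    where dA = degA (E [ P , Q ]) a

  edges-≤-A : ∀ {P Q m} → (∀ a → a ∈ P → degA (E [ P , Q ]) a ≤ m) → edges (E [ P , Q ]) ≤ m * ∣ P ∣
  edges-≤-A {P} bounded = sumF-≤-*∣∣ P bounded (λ a → degA-induced-∉)

  edges-≤-B : ∀ {P Q m} → (∀ b → b ∈ Q → degB (E [ P , Q ]) b ≤ m) → edges (E [ P , Q ]) ≤ m * ∣ Q ∣
  edges-≤-B {P} {Q} bounded =
    subst (_≤ _) (sym (edges≡sumF-degB (E [ P , Q ]))) (sumF-≤-*∣∣ Q bounded (λ b → degB-induced-∉))

  -- A record rather than a definition, so that α, β, P and Q can be inferred from its type.
  record Dense (α β : ℕ) (P Q : Subset n) : Set where
    constructor dense
    field
      weight<2·edges : α * ∣ P ∣ + β * ∣ Q ∣ < 2 * edges (E [ P , Q ])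

  dense-shrink : ∀ {α β P Q P′ Q′ w} c →
                 α * ∣ P ∣ + β * ∣ Q ∣ ≡ w + (α * ∣ P′ ∣ + β * ∣ Q′ ∣) →
                 edges (E [ P , Q ]) ≤ c + edges (E [ P′ , Q′ ]) → 2 * c ≤ w →
                 Dense α β P Q → Dense α β P′ Q′
  dense-shrink {α} {β} {P} {Q} {P′} {Q′} {w} c weights fewer cheap (dense w<e) =
    dense (+-cancelˡ-< w _ _ (begin-strict
      w + (α * ∣ P′ ∣ + β * ∣ Q′ ∣)      ≡⟨ weights ⟨
      α * ∣ P ∣ + β * ∣ Q ∣              <⟨ w<e ⟩
      2 * edges (E [ P , Q ])            ≤⟨ *-monoʳ-≤ 2 fewer ⟩
      2 * (c + edges (E [ P′ , Q′ ]))    ≡⟨ *-distribˡ-+ 2 c _ ⟩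
      2 * c + 2 * edges (E [ P′ , Q′ ])  ≤⟨ +-monoˡ-≤ _ cheap ⟩
      w + 2 * edges (E [ P′ , Q′ ])      ∎))

  dense-remove-A : ∀ {α β P Q a} → a ∈ P → 2 * degA (E [ P , Q ]) a ≤ α → Dense α β P Q → Dense α β (P - a) Q
  dense-remove-A {α} {β} {P} {Q} {a} a∈P = dense-shrink (degA (E [ P , Q ]) a) weights (edges-remove-A a)
    where
    weights : α * ∣ P ∣ + β * ∣ Q ∣ ≡ α + (α * ∣ P - a ∣ + β * ∣ Q ∣)
    weights = trans (cong (_+ β * ∣ Q ∣) (weight-remove {α = α} a∈P)) (+-assoc α _ _)

  dense-remove-B : ∀ {α β P Q b} → b ∈ Q → 2 * degB (E [ P , Q ]) b ≤ β → Dense α β P Q → Dense α β P (Q - b)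
  dense-remove-B {α} {β} {P} {Q} {b} b∈Q = dense-shrink (degB (E [ P , Q ]) b) weights (edges-remove-B b)
    where
    weights : α * ∣ P ∣ + β * ∣ Q ∣ ≡ β + (α * ∣ P ∣ + β * ∣ Q - b ∣)
    weights = trans (cong (α * ∣ P ∣ +_) (weight-remove {α = β} b∈Q)) (x∙yz≈y∙xz (α * ∣ P ∣) β _)

  dense-remove-AB : ∀ {α β P Q a b} → a ∈ P → b ∈ Q →
                    2 * (degA (E [ P , Q ]) a + degB (E [ P , Q ]) b) ≤ α + β →
                    Dense α β P Q → Dense α β (P - a) (Q - b)
  dense-remove-AB {α} {β} {P} {Q} {a} {b} a∈P b∈Q =
    dense-shrink (degA (E [ P , Q ]) a + degB (E [ P , Q ]) b) weights (edges-remove-AB a b)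
    where
    weights : α * ∣ P ∣ + β * ∣ Q ∣ ≡ (α + β) + (α * ∣ P - a ∣ + β * ∣ Q - b ∣)
    weights = trans (cong₂ _+_ (weight-remove {α = α} a∈P) (weight-remove {α = β} b∈Q)) (interchange α _ β _)

  ∃-high-degA : ∀ {K P Q} → Dense K K P Q → ∣ P ∣ ≤ ∣ Q ∣ → ∃[ a ] (a ∈ P × suc K ≤ degA (E [ P , Q ]) a)
  ∃-high-degA {K} {P} {Q} (dense w<e) p≤q with any? (λ a → a ∈? P ×-dec suc K ≤? degA (E [ P , Q ]) a)
  ... | yes high = high
  ... | no ¬high =
    contradiction p≤q (<⇒≱ (lighter-side {K} (subst (_< 2 * edges (E [ P , Q ])) (+-comm (K * ∣ P ∣) (K * ∣ Q ∣)) w<e) (edges-≤-A low)))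
    where
    low : ∀ a → a ∈ P → degA (E [ P , Q ]) a ≤ K
    low a a∈P = ≮⇒≥ (λ high → ¬high (a , a∈P , high))

  ∃-high-degB : ∀ {K P Q} → Dense K K P Q → ∣ Q ∣ ≤ ∣ P ∣ → ∃[ b ] (b ∈ Q × suc K ≤ degB (E [ P , Q ]) b)
  ∃-high-degB {K} {P} {Q} (dense w<e) q≤p with any? (λ b → b ∈? Q ×-dec suc K ≤? degB (E [ P , Q ]) b)
  ... | yes high = high
  ... | no ¬high = contradiction q≤p (<⇒≱ (lighter-side {K} w<e (edges-≤-B low)))
    where
    low : ∀ b → b ∈ Q → degB (E [ P , Q ]) b ≤ K
    low b b∈Q = ≮⇒≥ (λ high → ¬high (b , b∈Q , high))

-- k = 1 + t + s and r = 1 + s, so that r ≤ ⌈k/2⌉ becomes s ≤ t.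
module Peeling {n} (E : BipGraph n) (t s : ℕ) (s≤t : s ≤ t) where

  K : ℕ
  K = t + s

  -- e(H') > (k - r)|A'| + (r - 1)|B'|
  SkewDense : Subset n → Subset n → Set
  SkewDense = Dense E (2 * t) (2 * s)

  HighInH : Subset n → Set
  HighInH P = ∀ a → a ∈ P → t < degA E a

  Invariant : Subset n → Subset n → Set
  Invariant P Q = Dense E K K P Q × (SkewDense P Q ⊎ HighInH P)

  Shrinks : Subset n → Subset n → Set
  Shrinks P Q = ∃₂ λ P′ Q′ → ∣ P′ ∣ + ∣ Q′ ∣ < ∣ P ∣ + ∣ Q ∣ × Invariant P′ Q′

  Stable : Subset n → Subset n → Set
  Stable P Q = (∀ a → a ∈ P → suc K ≤ 2 * degA H a)
             × (∀ b → b ∈ Q → suc s ≤ degB H b)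
             × (∀ a b → a ∈ P → b ∈ Q → suc K ≤ degA H a + degB H b)
    where H = E [ P , Q ]

  Peeled : Subset n → Subset n → Set
  Peeled P Q =
    (K * (∣ P ∣ + ∣ Q ∣) < 2 * edges H) ×
    (∀ a b → a ∈ P → b ∈ Q → suc K ≤ degA H a + degB H b) ×
    (((∀ a → a ∈ P → suc K ≤ 2 * degA H a) ×
      (∀ b → b ∈ Q → suc s ≤ degB H b) ×
      (∃[ a ] (a ∈ P × suc K ≤ degA H a)) ×
      ∣ P ∣ ≤ ∣ Q ∣)
     ⊎
     ((∀ a → a ∈ P → suc K ≤ 2 * degA H a) ×
      (∀ b → b ∈ Q → suc K ≤ 2 * degB H b) ×
      (∃[ b ] (b ∈ Q × suc K ≤ degB H b)) ×
      (∀ a → a ∈ P → K ∸ s < degA E a)))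
    where H = E [ P , Q ]

  Dense⇒SkewDense : ∀ {P Q} → ∣ P ∣ ≤ ∣ Q ∣ → Dense E K K P Q → SkewDense P Q
  Dense⇒SkewDense p≤q (dense w<e) = dense (≤-<-trans (skew-≤-even s≤t p≤q) w<e)

  SkewDense⇒Dense : ∀ {P Q} → ∣ Q ∣ ≤ ∣ P ∣ → SkewDense P Q → Dense E K K P Q
  SkewDense⇒Dense q≤p (dense w<e) = dense (≤-<-trans (even-≤-skew s≤t q≤p) w<e)

  Dense⇒edges> : ∀ {P Q} → Dense E K K P Q → K * (∣ P ∣ + ∣ Q ∣) < 2 * edges (E [ P , Q ])
  Dense⇒edges> {P} {Q} (dense w<e) = subst (_< 2 * edges (E [ P , Q ])) (sym (*-distribˡ-+ K ∣ P ∣ ∣ Q ∣)) w<e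

  high-remove : ∀ {P} a → HighInH P → HighInH (P - a)
  high-remove {P} a high x x∈P-a = high x (p─q⊆p P _ x∈P-a)

  invariant-remove-A : ∀ {P Q a} → a ∈ P → 2 * degA (E [ P , Q ]) a ≤ K → Invariant P Q → Invariant (P - a) Q
  invariant-remove-A {a = a} a∈P cheap (d , rest) =
    dense-remove-A E a∈P cheap d ,
    Sum.map (dense-remove-A E a∈P (≤-trans cheap K≤2t)) (high-remove a) rest
    where
    K≤2t : K ≤ 2 * t
    K≤2t = subst (K ≤_) (sym (2*m≡m+m t)) (+-monoʳ-≤ t s≤t)

  invariant-remove-B : ∀ {P Q b} → b ∈ Q → degB (E [ P , Q ]) b ≤ s → Invariant P Q → Invariant P (Q - b)
  invariant-remove-B b∈Q low (d , rest) =
    dense-remove-B E b∈Q (2*-≤-+ (≤-trans low s≤t) low) d ,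
    Sum.map₁ (dense-remove-B E b∈Q (*-monoʳ-≤ 2 low)) rest

  invariant-remove-AB : ∀ {P Q a b} → a ∈ P → b ∈ Q → degA (E [ P , Q ]) a + degB (E [ P , Q ]) b ≤ K →
                        Invariant P Q → Invariant (P - a) (Q - b)
  invariant-remove-AB {a = a} a∈P b∈Q cheap (d , rest) =
    dense-remove-AB E a∈P b∈Q (2*-≤-+ cheap cheap) d ,
    Sum.map (dense-remove-AB E a∈P b∈Q (≤-trans (*-monoʳ-≤ 2 cheap) (≤-reflexive (*-distribˡ-+ 2 t s))))
            (high-remove a) rest

  stabilise : ∀ {P Q} → Invariant P Q → Stable P Q ⊎ Shrinks P Q
  stabilise {P} {Q} inv with any? (λ a → a ∈? P ×-dec 2 * degA (E [ P , Q ]) a ≤? K)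
  ... | yes (a , a∈P , cheap) =
    inj₂ (P - a , Q , +-monoˡ-< ∣ Q ∣ (x∈p⇒∣p-x∣<∣p∣ a∈P) , invariant-remove-A a∈P cheap inv)
  ... | no ¬cheapA with any? (λ b → b ∈? Q ×-dec degB (E [ P , Q ]) b ≤? s)
  ... | yes (b , b∈Q , low) =
    inj₂ (P , Q - b , +-monoʳ-< ∣ P ∣ (x∈p⇒∣p-x∣<∣p∣ b∈Q) , invariant-remove-B b∈Q low inv)
  ... | no ¬lowB with any? (λ a → any? (λ b → (a ∈? P ×-dec b ∈? Q) ×-dec
                                               degA (E [ P , Q ]) a + degB (E [ P , Q ]) b ≤? K))
  ... | yes (a , b , (a∈P , b∈Q) , cheap) =
    inj₂ (P - a , Q - b , +-mono-< (x∈p⇒∣p-x∣<∣p∣ a∈P) (x∈p⇒∣p-x∣<∣p∣ b∈Q) , invariant-remove-AB a∈P b∈Q cheap inv)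
  ... | no ¬cheapAB = inj₁
    ( (λ a a∈P → ≰⇒> (λ cheap → ¬cheapA (a , a∈P , cheap)))
    , (λ b b∈Q → ≰⇒> (λ low → ¬lowB (b , b∈Q , low)))
    , (λ a b a∈P b∈Q → ≰⇒> (λ cheap → ¬cheapAB (a , b , (a∈P , b∈Q) , cheap))))

  high-or-shrink : ∀ {P Q} → Invariant P Q → ∣ Q ∣ < ∣ P ∣ → HighInH P ⊎ Shrinks P Q
  high-or-shrink (_ , inj₂ high) _ = inj₁ high
  high-or-shrink {P} {Q} (_ , inj₁ skew) q<p with any? (λ a → a ∈? P ×-dec degA (E [ P , Q ]) a ≤? t)
  ... | yes (a , a∈P , low) =
    inj₂ (P - a , Q , +-monoˡ-< ∣ Q ∣ (x∈p⇒∣p-x∣<∣p∣ a∈P) , SkewDense⇒Dense q≤∣P-a∣ skew′ , inj₁ skew′)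
    where
    skew′ : SkewDense (P - a) Q
    skew′ = dense-remove-A E a∈P (*-monoʳ-≤ 2 low) skew
    q≤∣P-a∣ : ∣ Q ∣ ≤ ∣ P - a ∣
    q≤∣P-a∣ = s≤s⁻¹ (subst (∣ Q ∣ <_) (x∈p⇒∣p∣≡1+∣p-x∣ a∈P) q<p)
  ... | no ¬low = inj₁ (λ a a∈P → <-≤-trans (≰⇒> (λ low → ¬low (a , a∈P , low))) (degA-induced≤degA E a))

  conclude-II : ∀ {P Q} → Dense E K K P Q → Stable P Q → HighInH P → ∣ Q ∣ < ∣ P ∣ → Peeled P Q ⊎ Shrinks P Q
  conclude-II {P} {Q} d (halfA , _ , pairs) high q<p with any? (λ b → b ∈? Q ×-dec 2 * degB (E [ P , Q ]) b ≤? K)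
  ... | yes (b , b∈Q , cheap) =
    inj₂ (P , Q - b , +-monoʳ-< ∣ P ∣ (x∈p⇒∣p-x∣<∣p∣ b∈Q) , dense-remove-B E b∈Q cheap d , inj₂ high)
  ... | no ¬cheapB = inj₁ (Dense⇒edges> d , pairs , inj₂ (halfA , halfB , ∃-high-degB E d (<⇒≤ q<p) , high′))
    where
    halfB : ∀ b → b ∈ Q → suc K ≤ 2 * degB (E [ P , Q ]) b
    halfB b b∈Q = ≰⇒> (λ cheap → ¬cheapB (b , b∈Q , cheap))
    high′ : ∀ a → a ∈ P → K ∸ s < degA E a
    high′ a a∈P = subst (_< degA E a) (sym (m+n∸n≡m t s)) (high a a∈P)

  conclude : ∀ {P Q} → Invariant P Q → Stable P Q → Peeled P Q ⊎ Shrinks P Q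
  conclude {P} {Q} inv@(d , _) stable@(halfA , lowB , pairs) with ∣ P ∣ ≤? ∣ Q ∣
  ... | yes p≤q = inj₁ (Dense⇒edges> d , pairs , inj₁ (halfA , lowB , ∃-high-degA E d p≤q , p≤q))
  ... | no p≰q = [ (λ high → conclude-II d stable high (≰⇒> p≰q)) , inj₂ ]′ (high-or-shrink inv (≰⇒> p≰q))

  step : ∀ {P Q} → Invariant P Q → Peeled P Q ⊎ Shrinks P Q
  step inv = [ conclude inv , inj₂ ]′ (stabilise inv)

  peel-from : ∀ P Q → Acc _<_ (∣ P ∣ + ∣ Q ∣) → Invariant P Q → ∃₂ Peeled
  peel-from P Q (acc smaller) inv with step inv
  ... | inj₁ peeled = P , Q , peeled
  ... | inj₂ (P′ , Q′ , shrunk , inv′) = peel-from P′ Q′ (smaller shrunk) inv′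

  peel : K * (n + n) < 2 * edges E → ∃₂ Peeled
  peel e> = peel-from ⊤ ⊤ (<-wellFounded _) (d⊤ , inj₁ (Dense⇒SkewDense ≤-refl d⊤))
    where
    d⊤ : Dense E K K ⊤ ⊤
    d⊤ = dense (begin-strict
      K * ∣ ⊤ {n} ∣ + K * ∣ ⊤ {n} ∣  ≡⟨ cong (λ m → K * m + K * m) (∣⊤∣≡n n) ⟩
      K * n + K * n            ≡⟨ *-distribˡ-+ K n n ⟨
      K * (n + n)              <⟨ e> ⟩
      2 * edges E              ≤⟨ *-monoʳ-≤ 2 (edges≤edges-induced-⊤ E) ⟩
      2 * edges (E [ ⊤ , ⊤ ])  ∎)

lemma5p2 : (k r n : ℕ) → 1 ≤ k → 1 ≤ r → r ≤ ⌈ k /2⌉ →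
    (E : BipGraph n) →
    (k ∸ 1) * (n + n) < 2 * edges E →
    Σ (Subset n) λ A' → Σ (Subset n) λ B' → Σ (BipGraph n) λ E' →
      -- H' = (A' ∪ B', E') is a subgraph of H with parts A' ⊆ A, B' ⊆ B
      (∀ a b → E' a b ≡ true → (E a b ≡ true × a ∈ A' × b ∈ B')) ×
      -- (1) e(H') > (k-1)|H'|/2
      ((k ∸ 1) * (∣ A' ∣ + ∣ B' ∣) < 2 * edges E') ×
      -- (2)
      (∀ a b → a ∈ A' → b ∈ B' → k ≤ degA E' a + degB E' b) ×
      -- (3-I)
      (((∀ a → a ∈ A' → k ≤ 2 * degA E' a) ×
        (∀ b → b ∈ B' → r ≤ degB E' b) ×
        (∃[ a ] (a ∈ A' × k ≤ degA E' a)) ×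
        ∣ A' ∣ ≤ ∣ B' ∣)
      ⊎
      -- (3-II)
       ((∀ a → a ∈ A' → k ≤ 2 * degA E' a) ×
        (∀ b → b ∈ B' → k ≤ 2 * degB E' b) ×
        (∃[ b ] (b ∈ B' × k ≤ degB E' b)) ×
        (∀ a → a ∈ A' → k ∸ r < degA E a)))
lemma5p2 zero    _       _ () _  _       _ _
lemma5p2 (suc K) zero    _ _  () _       _ _
lemma5p2 (suc K) (suc s) n _  _  r≤⌈k/2⌉ E e> with r≤⌈k/2⌉⇒split r≤⌈k/2⌉
... | t , s≤t , refl with Peeling.peel E t s s≤t e>
... | P , Q , peeled = P , Q , E [ P , Q ] , induced-sound E , peeled
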